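{- Let $\Gamma$ be a semicomplete multipartite commutative weakly distance-regular digraph with $\{q\mid(1,q-1)\in\tilde\partial(\Gamma)\}=\{3,4\}$. Then $\tilde\partial(\Gamma)\subseteq\{(0,0),(1,2),(2,1),(1,3),(3,1),(2,2),(3,3)\}$.
   Context: A digraph has a finite vertex set and arcs that are ordered pairs of distinct vertices. $\partial(x,y)$ is the length of a shortest directed path from $x$ to $y$; strongly connected means all are finite. $\tilde\partial(x,y)=(\partial(x,y),\partial(y,x))$, $\tilde\partial(\Gamma)$ the set of these pairs, $\Gamma_{\tilde i}=\{(x,y):\tilde\partial(x,y)=\tilde i\}$. A strongly connected $\Gamma$ is weakly distance-regular if its arc relation is not symmetric and for all $\tilde i,\tilde j,\tilde h\in\tilde\partial(\Gamma)$ the number $|\{z:(x,z)\in\Gamma_{\tilde i},(z,y)\in\Gamma_{\tilde j}\}|$ is the same for all $(x,y)\in\Gamma_{\tilde h}$; commutative if this number is symmetric in $\tilde i,\tilde j$. $\Gamma$ is semicomplete multipartite if its underlying graph ($x\sim y$ iff $(x,y)$ or $(y,x)$ is an arc) is a complete multipartite graph with at least 2 parts, each of size at least 2. -}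

module Defs where

open import Data.Nat using (ℕ; zero; suc; _+_; _≤_)
open import Data.Nat using (_≡ᵇ_)
open import Data.Fin using (Fin)
open import Data.Fin.Properties using (_≟_)
open import Data.Bool using (Bool; true; false; _∧_; _∨_; if_then_else_)
open import Data.List using (List; length; filterᵇ)
open import Data.Bool.ListAction using (any)
open import Data.List.Base using (allFin)
open import Data.Maybe using (Maybe; just; nothing)
open import Data.Product using (_×_; _,_; Σ; ∃; ∃-syntax)
open import Relation.Nullary using (¬_; does)
open import Relation.Binary.PropositionalEquality using (_≡_; _≢_)
open import Relation.Nullary.Decidable using (⌊_⌋)
open import Data.Sum using (_⊎_)

record Digraph : Set where
  field
    n        : ℕ
    arc      : Fin n → Fin n → Bool
    loopless : ∀ x → arc x x ≡ false

module _ (Γ : Digraph) where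
  open Digraph Γ

  walkB : ℕ → Fin n → Fin n → Bool
  walkB zero    x y = ⌊ x ≟ y ⌋
  walkB (suc k) x y = any (λ z → arc x z ∧ walkB k z y) (allFin n)

  search : ℕ → ℕ → Fin n → Fin n → Maybe ℕ
  search s zero       x y = nothing
  search s (suc fuel) x y = if walkB s x y then just s else search (suc s) fuel x y

  -- ∂(x,y): length of a shortest directed path from x to y (nothing = ∞).
  -- A shortest walk is a path and has length < n, so searching k < n suffices.
  ∂ : Fin n → Fin n → Maybe ℕ
  ∂ x y = search 0 n x y

  StronglyConnected : Set
  StronglyConnected = ∀ x y → ∃[ d ] (∂ x y ≡ just d)

  ∂̃ : Fin n → Fin n → Maybe ℕ × Maybe ℕ
  ∂̃ x y = (∂ x y , ∂ y x)

  InSpec : ℕ × ℕ → Set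
  InSpec (i , j) = ∃[ x ] ∃[ y ] (∂̃ x y ≡ (just i , just j))

  InRel : ℕ × ℕ → Fin n → Fin n → Set
  InRel (i , j) x y = ∂̃ x y ≡ (just i , just j)

  inRelB : ℕ × ℕ → Fin n → Fin n → Bool
  inRelB (i , j) x y with ∂ x y | ∂ y x
  ... | just a | just b = (a ≡ᵇ i) ∧ (b ≡ᵇ j)
  ... | _      | _      = false

  count : ℕ × ℕ → ℕ × ℕ → Fin n → Fin n → ℕ
  count ĩ j̃ x y = length (filterᵇ (λ z → inRelB ĩ x z ∧ inRelB j̃ z y) (allFin n))

  Arc : Fin n → Fin n → Set
  Arc x y = arc x y ≡ true

  NonSymmetricArcs : Set
  NonSymmetricArcs = ∃[ x ] ∃[ y ] (Arc x y × ¬ Arc y x)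

  WeaklyDistanceRegular : Set
  WeaklyDistanceRegular =
    NonSymmetricArcs × StronglyConnected ×
    (∀ ĩ j̃ h̃ → InSpec ĩ → InSpec j̃ → InSpec h̃ →
       ∀ x y x′ y′ → InRel h̃ x y → InRel h̃ x′ y′ →
       count ĩ j̃ x y ≡ count ĩ j̃ x′ y′)

  Commutative : Set
  Commutative =
    ∀ ĩ j̃ h̃ → InSpec ĩ → InSpec j̃ → InSpec h̃ →
      ∀ x y → InRel h̃ x y → count ĩ j̃ x y ≡ count j̃ ĩ x y

  Adj : Fin n → Fin n → Set
  Adj x y = Arc x y ⊎ Arc y x

  SemicompleteMultipartite : Set
  SemicompleteMultipartite =
    Σ ℕ λ m → Σ (Fin n → Fin m) λ part →
      (2 ≤ m) ×
      (∀ c → ∃[ x ] ∃[ y ] (x ≢ y × part x ≡ c × part y ≡ c)) ×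
      (∀ x y → (Adj x y → part x ≢ part y) × (part x ≢ part y → Adj x y))

{-# OPTIONS --safe #-}

-- Every arc x → y has ∂(y,x) ∈ {2,3}, so there are no digons and the out-degree
-- k₍₁,₂₎ + k₍₁,₃₎ is constant. Vertices in different parts are adjacent, which gives
-- the types (1,2), (1,3) and their transposes. Distinct x, y in one part satisfy
-- ∂(x,y), ∂(y,x) ≥ 2. If ∂(x,y) = 2 < ∂(y,x), every out-neighbour of y is one of x
-- (an arc back to x would give ∂(y,x) ≤ 2), while the middle vertex of x → z → y is an
-- out-neighbour of x but not of y, contradicting the constant out-degree. If both
-- distances exceed 2, pick w → x with ∂(x,w) = 2, which exists because (2,1) ∈ ∂̃(Γ)
-- and valencies are constant; then w → y (else y → w → x), so ∂(x,y) ≤ 3.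

module Submission where

open import Defs
open import Data.Nat using (ℕ; _≡ᵇ_; zero; suc; _+_; _∸_; _≤_; _<_; z≤n; s≤s)
open import Data.Nat.Properties as ℕ using (≤-trans; <⇒≤; ≮⇒≥; ≤∧≢⇒<; <⇒≱; +-suc; m≤n⇒m≤1+n; m<m+n; n≤0⇒n≡0; n≢0⇒n>0; ≤-antisym; <⇒≢; ≡ᵇ⇒≡; ≡⇒≡ᵇ; suc-injective)
open import Data.Fin using (Fin)
open import Data.Fin.Properties using (_≟_)
open import Data.Bool using (Bool; true; false; _∧_)
open import Data.Bool.Properties using (T-≡; T-∧; ¬-not)
open import Data.List using (List; []; _∷_; length; filterᵇ; allFin)
open import Data.List.Properties using (filter-some)
open import Data.List.Membership.Propositional using (_∈_; lose)
open import Data.List.Membership.Propositional.Properties using (∈-allFin)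
open import Data.List.Relation.Unary.Any using (here; there; satisfied)
open import Data.List.Relation.Unary.Any.Properties using (any⁺; any⁻)
open import Data.Maybe using (just; nothing)
open import Data.Maybe.Properties using (just-injective)
open import Data.Product using (_×_; _,_; proj₁; proj₂; ∃-syntax; swap)
open import Data.Sum using (_⊎_; inj₁; inj₂; [_,_]′)
import Data.Sum as Sum
open import Function using (_∘_)
open import Function.Bundles using (_⇔_; mk⇔; Equivalence)
open import Relation.Nullary using (¬_; Dec; yes; no; contradiction)
open import Relation.Nullary.Decidable using (T?; toWitness; fromWitness)
open import Relation.Binary.PropositionalEquality using (_≡_; _≢_; refl; sym; trans; cong; cong₂; subst; module ≡-Reasoning)

open Equivalence using (to; from)

∧≡true⇔ : ∀ {a b} → a ∧ b ≡ true ⇔ (a ≡ true × b ≡ true)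
∧≡true⇔ {true}  = mk⇔ (refl ,_) proj₂
∧≡true⇔ {false} = mk⇔ (λ ()) ((λ ()) ∘ proj₁)

module _ {A : Set} where

  length-filterᵇ-witness : ∀ (p : A → Bool) xs → 0 < length (filterᵇ p xs) → ∃[ z ] p z ≡ true
  length-filterᵇ-witness p (x ∷ xs) pos with p x in px
  ... | true  = x , px
  ... | false = length-filterᵇ-witness p xs pos

  length-filterᵇ-positive : ∀ (p : A → Bool) {xs z} → z ∈ xs → p z ≡ true → 0 < length (filterᵇ p xs)
  length-filterᵇ-positive p z∈xs pz = filter-some (T? ∘ p) (lose z∈xs (from T-≡ pz))

  length-filterᵇ-mono-≤ : ∀ (p q : A → Bool) xs → (∀ z → p z ≡ true → q z ≡ true) →
                        length (filterᵇ p xs) ≤ length (filterᵇ q xs)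
  length-filterᵇ-mono-≤ p q []       p⇒q = z≤n
  length-filterᵇ-mono-≤ p q (x ∷ xs) p⇒q
    with ih ← length-filterᵇ-mono-≤ p q xs p⇒q | p x in px | q x in qx
  ... | true  | true  = s≤s ih
  ... | false | true  = m≤n⇒m≤1+n ih
  ... | false | false = ih
  ... | true  | false = contradiction (trans (sym (p⇒q x px)) qx) λ ()

  length-filterᵇ-mono-< : ∀ (p q : A → Bool) {xs z} → (∀ z → p z ≡ true → q z ≡ true) →
                          z ∈ xs → q z ≡ true → p z ≡ false →
                          length (filterᵇ p xs) < length (filterᵇ q xs)
  length-filterᵇ-mono-< p q {_ ∷ xs} p⇒q (here refl) qz pz rewrite qz | pz =
    s≤s (length-filterᵇ-mono-≤ p q xs p⇒q)
  length-filterᵇ-mono-< p q {x ∷ xs} p⇒q (there z∈xs) qz pz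
    with ih ← length-filterᵇ-mono-< p q p⇒q z∈xs qz pz | p x in px | q x in qx
  ... | true  | true  = s≤s ih
  ... | false | true  = m≤n⇒m≤1+n ih
  ... | false | false = ih
  ... | true  | false = contradiction (trans (sym (p⇒q x px)) qx) λ ()

  length-filterᵇ-⊎ : ∀ (r p q : A → Bool) xs →
                     (∀ z → r z ≡ true ⇔ (p z ≡ true ⊎ q z ≡ true)) →
                     (∀ z → p z ≡ true → q z ≢ true) →
                     length (filterᵇ r xs) ≡ length (filterᵇ p xs) + length (filterᵇ q xs)
  length-filterᵇ-⊎ r p q []       r⇔p⊎q p#q = refl
  length-filterᵇ-⊎ r p q (x ∷ xs) r⇔p⊎q p#q
    with ih ← length-filterᵇ-⊎ r p q xs r⇔p⊎q p#q | r x in rx | p x in px | q x in qx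
  ... | true  | true  | true  = contradiction qx (p#q x px)
  ... | true  | true  | false = cong suc ih
  ... | true  | false | true  = trans (cong suc ih) (sym (+-suc _ _))
  ... | false | false | false = ih
  ... | false | true  | _     = contradiction (trans (sym (from (r⇔p⊎q x) (inj₁ px))) rx) λ ()
  ... | false | false | true  = contradiction (trans (sym (from (r⇔p⊎q x) (inj₂ qx))) rx) λ ()
  ... | true  | false | false with to (r⇔p⊎q x) rx
  ...   | inj₁ px′ = contradiction (trans (sym px′) px) λ ()
  ...   | inj₂ qx′ = contradiction (trans (sym qx′) qx) λ ()

module _ (Γ : Digraph) where
  open Digraph Γ

  walkB-zero⁻ : ∀ {x y} → walkB Γ 0 x y ≡ true → x ≡ y
  walkB-zero⁻ w = toWitness (from T-≡ w)

  walkB-zero-refl : ∀ x → walkB Γ 0 x x ≡ true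
  walkB-zero-refl x = to T-≡ (fromWitness refl)

  walkB-suc⁻ : ∀ {k x y} → walkB Γ (suc k) x y ≡ true → ∃[ z ] (Arc Γ x z × walkB Γ k z y ≡ true)
  walkB-suc⁻ {k} {x} {y} w =
    let z , t = satisfied (any⁻ (λ z → arc x z ∧ walkB Γ k z y) (allFin n) (from T-≡ w))
    in z , to ∧≡true⇔ (to T-≡ t)

  walkB-suc⁺ : ∀ {k x z y} → Arc Γ x z → walkB Γ k z y ≡ true → walkB Γ (suc k) x y ≡ true
  walkB-suc⁺ {k} {x} {z} {y} x→z z⇝y =
    to T-≡ (any⁺ (λ z → arc x z ∧ walkB Γ k z y)
                 (lose (∈-allFin z) (from T-≡ (from ∧≡true⇔ (x→z , z⇝y)))))

  search-sound : ∀ s f {x y d} → search Γ s f x y ≡ just d → walkB Γ d x y ≡ true × d < s + f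
  search-sound s (suc f) {x} {y} {d} h with walkB Γ s x y in w
  ... | true  with refl ← just-injective h = w , m<m+n s (s≤s z≤n)
  ... | false with w′ , d< ← search-sound (suc s) f h = w′ , subst (d <_) (sym (+-suc s f)) d<

  search-least : ∀ s f {x y d k} → search Γ s f x y ≡ just d →
                 s ≤ k → k < s + f → walkB Γ k x y ≡ true → d ≤ k
  search-least s (suc f) {x} {y} {d} {k} h s≤k k< wk with walkB Γ s x y in ws
  ... | true with refl ← just-injective h = s≤k
  ... | false with s ℕ.≟ k
  ...   | yes refl = contradiction (trans (sym wk) ws) λ ()
  ...   | no s≢k   = search-least (suc s) f h (≤∧≢⇒< s≤k s≢k) (subst (k <_) (+-suc s f) k<) wk

  ∂-walk : ∀ {x y d} → ∂ Γ x y ≡ just d → walkB Γ d x y ≡ true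
  ∂-walk h = proj₁ (search-sound 0 n h)

  ∂-least : ∀ {x y d k} → ∂ Γ x y ≡ just d → walkB Γ k x y ≡ true → d ≤ k
  ∂-least {k = k} h w with k ℕ.<? n
  ... | yes k<n = search-least 0 n h z≤n k<n w
  ... | no  k≮n = ≤-trans (<⇒≤ (proj₂ (search-sound 0 n h))) (≮⇒≥ k≮n)

  walkB-one⇒Arc : ∀ {x y} → walkB Γ 1 x y ≡ true → Arc Γ x y
  walkB-one⇒Arc {x} w with z , x→z , z⇝y ← walkB-suc⁻ {0} w = subst (Arc Γ x) (walkB-zero⁻ z⇝y) x→z

  ∂≡1⇒Arc : ∀ {x y} → ∂ Γ x y ≡ just 1 → Arc Γ x y
  ∂≡1⇒Arc h = walkB-one⇒Arc (∂-walk h)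

  ∂≡2⇒path : ∀ {x y} → ∂ Γ x y ≡ just 2 → ∃[ z ] (Arc Γ x z × Arc Γ z y)
  ∂≡2⇒path h with z , x→z , z⇝y ← walkB-suc⁻ {1} (∂-walk h) = z , x→z , walkB-one⇒Arc z⇝y

  inRelB⇔InRel : ∀ ĩ x y → inRelB Γ ĩ x y ≡ true ⇔ InRel Γ ĩ x y
  inRelB⇔InRel (i , j) x y with ∂ Γ x y | ∂ Γ y x
  ... | just a  | just b  = mk⇔ sound complete
    where
    sound : ((a ≡ᵇ i) ∧ (b ≡ᵇ j)) ≡ true → (just a , just b) ≡ (just i , just j)
    sound h with a≡i , b≡j ← to T-∧ (from T-≡ h)
            with refl ← ≡ᵇ⇒≡ a i a≡i | refl ← ≡ᵇ⇒≡ b j b≡j = refl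
    complete : (just a , just b) ≡ (just i , just j) → ((a ≡ᵇ i) ∧ (b ≡ᵇ j)) ≡ true
    complete refl = to T-≡ (from T-∧ (≡⇒≡ᵇ a a refl , ≡⇒≡ᵇ b b refl))
  ... | just _  | nothing = mk⇔ (λ ()) (λ ())
  ... | nothing | _       = mk⇔ (λ ()) (λ ())

  InRel-swap : ∀ {ĩ x y} → InRel Γ ĩ x y → InRel Γ (swap ĩ) y x
  InRel-swap = cong swap

  InSpec-swap : ∀ {ĩ} → InSpec Γ ĩ → InSpec Γ (swap ĩ)
  InSpec-swap (x , y , e) = y , x , InRel-swap e

  InRel-functional : ∀ {ĩ j̃ x y} → InRel Γ ĩ x y → InRel Γ j̃ x y → ĩ ≡ j̃
  InRel-functional e e′ with refl ← trans (sym e) e′ = refl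

  InRel⇒Arc : ∀ {j x y} → InRel Γ (1 , j) x y → Arc Γ x y
  InRel⇒Arc e = ∂≡1⇒Arc (cong proj₁ e)

  Arc⇒≢ : ∀ {x y} → Arc Γ x y → x ≢ y
  Arc⇒≢ {x} x→x refl = contradiction (trans (sym (loopless x)) x→x) λ ()

module Distance {Γ : Digraph} (sc : StronglyConnected Γ) where
  open Digraph Γ

  dist : Fin n → Fin n → ℕ
  dist x y = proj₁ (sc x y)

  ∂≡dist : ∀ x y → ∂ Γ x y ≡ just (dist x y)
  ∂≡dist x y = proj₂ (sc x y)

  dist-least : ∀ {k x y} → walkB Γ k x y ≡ true → dist x y ≤ k
  dist-least = ∂-least Γ (∂≡dist _ _)

  dist-refl : ∀ x → dist x x ≡ 0
  dist-refl x = n≤0⇒n≡0 (dist-least (walkB-zero-refl Γ x))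

  dist≡⇒∂≡ : ∀ {x y d} → dist x y ≡ d → ∂ Γ x y ≡ just d
  dist≡⇒∂≡ {x} {y} refl = ∂≡dist x y

  dist≡0⇒≡ : ∀ {x y} → dist x y ≡ 0 → x ≡ y
  dist≡0⇒≡ d≡0 = walkB-zero⁻ Γ (∂-walk Γ (dist≡⇒∂≡ d≡0))

  dist≡1⇒Arc : ∀ {x y} → dist x y ≡ 1 → Arc Γ x y
  dist≡1⇒Arc d≡1 = ∂≡1⇒Arc Γ (dist≡⇒∂≡ d≡1)

  dist≡2⇒path : ∀ {x y} → dist x y ≡ 2 → ∃[ z ] (Arc Γ x z × Arc Γ z y)
  dist≡2⇒path d≡2 = ∂≡2⇒path Γ (dist≡⇒∂≡ d≡2)

  Arc⇒dist≡1 : ∀ {x y} → Arc Γ x y → dist x y ≡ 1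
  Arc⇒dist≡1 {x} {y} x→y =
    ≤-antisym (dist-least (walkB-suc⁺ Γ {0} x→y (walkB-zero-refl Γ y)))
              (n≢0⇒n>0 (Arc⇒≢ Γ x→y ∘ dist≡0⇒≡))

  path⇒dist≤2 : ∀ {x z y} → Arc Γ x z → Arc Γ z y → dist x y ≤ 2
  path⇒dist≤2 {y = y} x→z z→y =
    dist-least (walkB-suc⁺ Γ {1} x→z (walkB-suc⁺ Γ {0} z→y (walkB-zero-refl Γ y)))

  path⇒dist≤3 : ∀ {x z w y} → Arc Γ x z → Arc Γ z w → Arc Γ w y → dist x y ≤ 3
  path⇒dist≤3 {y = y} x→z z→w w→y =
    dist-least (walkB-suc⁺ Γ {2} x→z (walkB-suc⁺ Γ {1} z→w (walkB-suc⁺ Γ {0} w→y (walkB-zero-refl Γ y))))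

  InRel⇔dist : ∀ {i j x y} → InRel Γ (i , j) x y ⇔ (dist x y ≡ i × dist y x ≡ j)
  InRel⇔dist {x = x} {y} = mk⇔ sound complete
    where
    sound : ∀ {i j} → InRel Γ (i , j) x y → dist x y ≡ i × dist y x ≡ j
    sound e = just-injective (trans (sym (∂≡dist x y)) (cong proj₁ e)) ,
              just-injective (trans (sym (∂≡dist y x)) (cong proj₂ e))
    complete : ∀ {i j} → dist x y ≡ i × dist y x ≡ j → InRel Γ (i , j) x y
    complete (refl , refl) = cong₂ _,_ (∂≡dist x y) (∂≡dist y x)

  Arc⇒InRel : ∀ {j x y} → Arc Γ x y → dist y x ≡ j → InRel Γ (1 , j) x y
  Arc⇒InRel x→y dyx≡j = from InRel⇔dist (Arc⇒dist≡1 x→y , dyx≡j)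

  InRel-refl : ∀ x → InRel Γ (0 , 0) x x
  InRel-refl x = from InRel⇔dist (dist-refl x , dist-refl x)

module _ (Γ : Digraph) where
  open Digraph Γ

  valency : ℕ × ℕ → Fin n → ℕ
  valency ĩ x = count Γ ĩ (swap ĩ) x x

  outdegree : Fin n → ℕ
  outdegree x = length (filterᵇ (arc x) (allFin n))

  neighbourB : ℕ × ℕ → Fin n → Fin n → Bool
  neighbourB ĩ x z = inRelB Γ ĩ x z ∧ inRelB Γ (swap ĩ) z x

  neighbourB⇔InRel : ∀ {ĩ x z} → neighbourB ĩ x z ≡ true ⇔ InRel Γ ĩ x z
  neighbourB⇔InRel {ĩ} {x} {z} = mk⇔
    (to (inRelB⇔InRel Γ ĩ x z) ∘ proj₁ ∘ to ∧≡true⇔)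
    (λ e → from ∧≡true⇔ (from (inRelB⇔InRel Γ ĩ x z) e ,
                          from (inRelB⇔InRel Γ (swap ĩ) z x) (InRel-swap Γ e)))

  valency-positive : ∀ {ĩ x z} → InRel Γ ĩ x z → 0 < valency ĩ x
  valency-positive {z = z} e = length-filterᵇ-positive _ (∈-allFin z) (from neighbourB⇔InRel e)

  valency-witness : ∀ {ĩ x} → 0 < valency ĩ x → ∃[ z ] InRel Γ ĩ x z
  valency-witness pos with z , h ← length-filterᵇ-witness _ (allFin n) pos = z , to neighbourB⇔InRel h

  outdegree≡valency+valency : ∀ {a b} → a ≢ b →
    (∀ {x y} → Arc Γ x y → InRel Γ (1 , a) x y ⊎ InRel Γ (1 , b) x y) →
    ∀ x → outdegree x ≡ valency (1 , a) x + valency (1 , b) x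
  outdegree≡valency+valency {a} {b} a≢b arc-types x =
    length-filterᵇ-⊎ (arc x) (neighbourB (1 , a) x) (neighbourB (1 , b) x) (allFin n) arc⇔types disjoint
    where
    arc⇔types : ∀ z → Arc Γ x z ⇔ (neighbourB (1 , a) x z ≡ true ⊎ neighbourB (1 , b) x z ≡ true)
    arc⇔types z = mk⇔
      (Sum.map (from neighbourB⇔InRel) (from neighbourB⇔InRel) ∘ arc-types)
      ([ InRel⇒Arc Γ , InRel⇒Arc Γ ]′ ∘ Sum.map (to neighbourB⇔InRel) (to neighbourB⇔InRel))
    disjoint : ∀ z → neighbourB (1 , a) x z ≡ true → neighbourB (1 , b) x z ≢ true
    disjoint z za zb =
      a≢b (cong proj₂ (InRel-functional Γ (to neighbourB⇔InRel za) (to neighbourB⇔InRel zb)))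

module _ {Γ : Digraph} (W : WeaklyDistanceRegular Γ) where
  open Distance (proj₁ (proj₂ W))

  valency-constant : ∀ {ĩ} → InSpec Γ ĩ → ∀ x y → valency Γ ĩ x ≡ valency Γ ĩ y
  valency-constant {ĩ} ĩ∈∂̃ x y =
    proj₂ (proj₂ W) ĩ (swap ĩ) (0 , 0) ĩ∈∂̃ (InSpec-swap Γ ĩ∈∂̃) (x , x , InRel-refl x)
                    x x y y (InRel-refl x) (InRel-refl y)

  InSpec⇒∃InRel : ∀ {ĩ} → InSpec Γ ĩ → ∀ x → ∃[ z ] InRel Γ ĩ x z
  InSpec⇒∃InRel ĩ∈∂̃ x with u , v , e ← ĩ∈∂̃ =
    valency-witness Γ (subst (0 <_) (valency-constant ĩ∈∂̃ u x) (valency-positive Γ e))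

module Multipartite {Γ : Digraph} (sc : StronglyConnected Γ) (SM : SemicompleteMultipartite Γ) where
  open Digraph Γ
  open Distance sc

  part : Fin n → Fin (proj₁ SM)
  part = proj₁ (proj₂ SM)

  private
    adjacency : ∀ x y → (Adj Γ x y → part x ≢ part y) × (part x ≢ part y → Adj Γ x y)
    adjacency = proj₂ (proj₂ (proj₂ (proj₂ SM)))

  same-part⇒¬Arc : ∀ {x y} → part x ≡ part y → ¬ Arc Γ x y
  same-part⇒¬Arc {x} {y} same x→y = proj₁ (adjacency x y) (inj₁ x→y) same

  different-parts⇒Adj : ∀ {x y} → part x ≢ part y → Adj Γ x y
  different-parts⇒Adj {x} {y} = proj₂ (adjacency x y)

  Arc⇒different-parts : ∀ {x y} → Arc Γ x y → part x ≢ part y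
  Arc⇒different-parts x→y same = same-part⇒¬Arc same x→y

  same-part⇒2≤dist : ∀ {x y} → part x ≡ part y → x ≢ y → 2 ≤ dist x y
  same-part⇒2≤dist {x} {y} same x≢y with dist x y in d
  ... | zero        = contradiction (dist≡0⇒≡ d) x≢y
  ... | suc zero    = contradiction (dist≡1⇒Arc d) (same-part⇒¬Arc same)
  ... | suc (suc _) = s≤s (s≤s z≤n)

  out-neighbours-inherited : ∀ {x y z} → part x ≡ part y → 2 < dist y x → Arc Γ y z → Arc Γ x z
  out-neighbours-inherited {x} {y} {z} same 2<dyx y→z
    with different-parts⇒Adj (λ xz → Arc⇒different-parts y→z (trans (sym same) xz))
  ... | inj₁ x→z = x→z
  ... | inj₂ z→x = contradiction (path⇒dist≤2 y→z z→x) (<⇒≱ 2<dyx)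

  dist≤3-via-in-neighbour : ∀ {x y w} → part x ≡ part y → 2 < dist y x →
                            Arc Γ w x → dist x w ≡ 2 → dist x y ≤ 3
  dist≤3-via-in-neighbour {x} {y} {w} same 2<dyx w→x dxw≡2
    with z , x→z , z→w ← dist≡2⇒path dxw≡2
    with different-parts⇒Adj (λ wy → Arc⇒different-parts w→x (trans wy (sym same)))
  ... | inj₁ w→y = path⇒dist≤3 x→z z→w w→y
  ... | inj₂ y→w = contradiction (path⇒dist≤2 y→w w→x) (<⇒≱ 2<dyx)

module ArcTypes12and13 (Γ : Digraph) (SM : SemicompleteMultipartite Γ) (W : WeaklyDistanceRegular Γ)
                       (H : ∀ q → InSpec Γ (1 , q ∸ 1) ⇔ (q ≡ 3 ⊎ q ≡ 4)) where
  open Digraph Γ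

  sc : StronglyConnected Γ
  sc = proj₁ (proj₂ W)

  open Distance sc public
  open Multipartite sc SM public

  inSpec₁₂ : InSpec Γ (1 , 2)
  inSpec₁₂ = from (H 3) (inj₁ refl)

  inSpec₁₃ : InSpec Γ (1 , 3)
  inSpec₁₃ = from (H 4) (inj₂ refl)

  arc-back-distance : ∀ {x y} → Arc Γ x y → dist y x ≡ 2 ⊎ dist y x ≡ 3
  arc-back-distance {x} {y} x→y =
    Sum.map suc-injective suc-injective (to (H (suc (dist y x))) (x , y , Arc⇒InRel x→y refl))

  arc-types : ∀ {x y} → Arc Γ x y → InRel Γ (1 , 2) x y ⊎ InRel Γ (1 , 3) x y
  arc-types x→y = Sum.map (Arc⇒InRel x→y) (Arc⇒InRel x→y) (arc-back-distance x→y)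

  no-digon : ∀ {x y} → Arc Γ x y → ¬ Arc Γ y x
  no-digon x→y y→x with arc-back-distance x→y
  ... | inj₁ dyx≡2 = contradiction (trans (sym (Arc⇒dist≡1 y→x)) dyx≡2) λ ()
  ... | inj₂ dyx≡3 = contradiction (trans (sym (Arc⇒dist≡1 y→x)) dyx≡3) λ ()

  outdegree-constant : ∀ x y → outdegree Γ x ≡ outdegree Γ y
  outdegree-constant x y = begin
    outdegree Γ x                             ≡⟨ outdegree≡valency+valency Γ (λ ()) arc-types x ⟩
    valency Γ (1 , 2) x + valency Γ (1 , 3) x ≡⟨ cong₂ _+_ (valency-constant W inSpec₁₂ x y)
                                                           (valency-constant W inSpec₁₃ x y) ⟩
    valency Γ (1 , 2) y + valency Γ (1 , 3) y ≡⟨ outdegree≡valency+valency Γ (λ ()) arc-types y ⟨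
    outdegree Γ y                             ∎
    where open ≡-Reasoning

  in-neighbour-at-distance-2 : ∀ x → ∃[ w ] (Arc Γ w x × dist x w ≡ 2)
  in-neighbour-at-distance-2 x
    with w , xw∈Γ₂₁ ← InSpec⇒∃InRel W (InSpec-swap Γ inSpec₁₂) x
    with dxw≡2 , dwx≡1 ← to InRel⇔dist xw∈Γ₂₁
    = w , dist≡1⇒Arc dwx≡1 , dxw≡2

  same-part-far⇒dist≤3 : ∀ {x y} → part x ≡ part y → 2 < dist y x → dist x y ≤ 3
  same-part-far⇒dist≤3 {x} same 2<dyx with w , w→x , dxw≡2 ← in-neighbour-at-distance-2 x =
    dist≤3-via-in-neighbour same 2<dyx w→x dxw≡2

  same-part-dist≡2⇒dist≡2 : ∀ {x y} → part x ≡ part y → dist x y ≡ 2 → dist y x ≡ 2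
  same-part-dist≡2⇒dist≡2 {x} {y} same dxy≡2 with dist y x ℕ.≟ 2
  ... | yes dyx≡2 = dyx≡2
  ... | no  dyx≢2 = contradiction (outdegree-constant y x) (<⇒≢ outdegree-y<x)
    where
    x≢y : x ≢ y
    x≢y refl = contradiction (trans (sym (dist-refl x)) dxy≡2) λ ()
    2<dyx : 2 < dist y x
    2<dyx = ≤∧≢⇒< (same-part⇒2≤dist (sym same) (x≢y ∘ sym)) (dyx≢2 ∘ sym)
    outdegree-y<x : outdegree Γ y < outdegree Γ x
    outdegree-y<x with z , x→z , z→y ← dist≡2⇒path dxy≡2 =
      length-filterᵇ-mono-< (arc y) (arc x) (λ _ → out-neighbours-inherited same 2<dyx)
                             (∈-allFin z) x→z (¬-not (no-digon z→y))

  same-part-types : ∀ {x y} → part x ≡ part y → x ≢ y → InRel Γ (2 , 2) x y ⊎ InRel Γ (3 , 3) x y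
  same-part-types {x} {y} same x≢y with dist x y ℕ.≟ 2 | dist y x ℕ.≟ 2
  ... | yes dxy≡2 | _         = inj₁ (from InRel⇔dist (dxy≡2 , same-part-dist≡2⇒dist≡2 same dxy≡2))
  ... | no _      | yes dyx≡2 = inj₁ (from InRel⇔dist (same-part-dist≡2⇒dist≡2 (sym same) dyx≡2 , dyx≡2))
  ... | no dxy≢2  | no dyx≢2  = inj₂ (from InRel⇔dist
    (≤-antisym (same-part-far⇒dist≤3 same 2<dyx) 2<dxy ,
     ≤-antisym (same-part-far⇒dist≤3 (sym same) 2<dxy) 2<dyx))
    where
    2<dxy : 2 < dist x y
    2<dxy = ≤∧≢⇒< (same-part⇒2≤dist same x≢y) (dxy≢2 ∘ sym)
    2<dyx : 2 < dist y x
    2<dyx = ≤∧≢⇒< (same-part⇒2≤dist (sym same) (x≢y ∘ sym)) (dyx≢2 ∘ sym)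

spectrum-bound : List (ℕ × ℕ)
spectrum-bound = (0 , 0) ∷ (1 , 2) ∷ (2 , 1) ∷ (1 , 3) ∷ (3 , 1) ∷ (2 , 2) ∷ (3 , 3) ∷ []

lemma7p1 : (Γ : Digraph) → SemicompleteMultipartite Γ → WeaklyDistanceRegular Γ → Commutative Γ →
    (∀ q → InSpec Γ (1 , q ∸ 1) ⇔ (q ≡ 3 ⊎ q ≡ 4)) →
    ∀ ĩ → InSpec Γ ĩ →
      ĩ ∈ ((0 , 0) ∷ (1 , 2) ∷ (2 , 1) ∷ (1 , 3) ∷ (3 , 1) ∷ (2 , 2) ∷ (3 , 3) ∷ [])
lemma7p1 Γ SM W _ H ĩ (x , y , xy∈Γĩ) = classify (x ≟ y) (part x ≟ part y)
  where
  open ArcTypes12and13 Γ SM W H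
  listed : ∀ {j̃} → j̃ ∈ spectrum-bound → InRel Γ j̃ x y → ĩ ∈ spectrum-bound
  listed j̃∈bound xy∈Γj̃ = subst (_∈ spectrum-bound) (InRel-functional Γ xy∈Γj̃ xy∈Γĩ) j̃∈bound
  classify : Dec (x ≡ y) → Dec (part x ≡ part y) → ĩ ∈ spectrum-bound
  classify (yes refl) _ = listed (here refl) (InRel-refl x)
  classify (no x≢y) (yes same) =
    [ listed (there (there (there (there (there (here refl)))))) ,
      listed (there (there (there (there (there (there (here refl))))))) ]′ (same-part-types same x≢y)
  classify (no _) (no different) =
    [ [ listed (there (here refl)) , listed (there (there (there (here refl)))) ]′ ∘ arc-types ,
      [ listed (there (there (here refl))) ∘ InRel-swap Γ ,
        listed (there (there (there (there (here refl))))) ∘ InRel-swap Γ ]′ ∘ arc-types ]′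
    (different-parts⇒Adj different)
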